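{- Let $G$ be a graph, $k\in\mathbb N$, and let $\mathcal F$ be a set of stars in $\vec S_k(G)$ all of which have finite interior. Then every end $\varepsilon$ of $G$ induces an $\mathcal F$-tangle of $S_k(G)$, i.e. $\tau_\varepsilon\cap\vec S_k(G)$ is an $\mathcal F$-tangle of $S_k(G)$.
   Context: A separation of a graph $G$ is a set $\{A,B\}$ of subsets of $V(G)$ with $A\cup B=V(G)$ and no edge of $G$ between $A\setminus B$ and $B\setminus A$; its order is $|A\cap B|$. $S_k(G)$ is the set of separations of order $<k$ and $\vec S_k(G)$ the set of their orientations $(A,B),(B,A)$. $(A,B)\le(C,D)$ iff $A\subseteq C$, $B\supseteq D$. An orientation of $S$ is a set containing exactly one orientation of each element of $S$; it is consistent if there are no distinct $\{A,B\},\{C,D\}\in S$ with $(A,B)<(C,D)$, $(B,A)\in O$, $(C,D)\in O$. An $\mathcal F$-tangle of $S$ is a consistent orientation of $S$ containing no element of $\mathcal F$ as a subset. A star is a set $\sigma$ of oriented finite-order separations, not containing $(V(G),V(G))$, with $(A,B)\le(D,C)$ for all distinct $(A,B),(C,D)\in\sigma$; its interior is $\bigcap_{(A,B)\in\sigma}B$. An end of $G$ is an equivalence class of rays (one-way infinite paths), two rays being equivalent if for every finite $X\subseteq V(G)$ they have tails in the same component of $G-X$; $\tau_\varepsilon$ is the set of finite-order oriented separations $(A,B)$ such that $G[B\setminus A]$ contains a tail of a ray of $\varepsilon$. -}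

module Defs where

open import Level using (Level; 0ℓ) renaming (suc to lsuc)
open import Data.Nat using (ℕ; suc; _<_; _≥_)
open import Data.List using (List; length)
open import Data.List.Membership.Propositional using (_∈_)
open import Data.Product using (Σ; ∃; _×_; _,_)
open import Data.Sum using (_⊎_)
open import Data.Empty using (⊥)
open import Relation.Nullary using (¬_)
open import Function.Definitions using (Injective)
open import Relation.Binary.PropositionalEquality using (_≡_)

record Graph : Set₁ where
  field
    V     : Set
    E     : V → V → Set
    E-sym : ∀ {u v} → E u v → E v u
    E-irr : ∀ {u} → ¬ E u u

Subset : Set → Set₁
Subset X = X → Set

_⊆_ : {X : Set} → Subset X → Subset X → Set
P ⊆ Q = ∀ x → P x → Q x

_≐_ : {X : Set} → Subset X → Subset X → Set
P ≐ Q = (P ⊆ Q) × (Q ⊆ P)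

_∩_ : {X : Set} → Subset X → Subset X → Subset X
(P ∩ Q) x = P x × Q x

_∖_ : {X : Set} → Subset X → Subset X → Subset X
(P ∖ Q) x = P x × ¬ Q x

Finite : ∀ {ℓ} {X : Set} → (X → Set ℓ) → Set ℓ
Finite {X = X} P = Σ (List X) λ l → ∀ x → P x → x ∈ l

CardLt : {X : Set} → Subset X → ℕ → Set
CardLt {X} P k = Σ (List X) λ l → (length l < k) × (∀ x → P x → x ∈ l)

module _ (G : Graph) where
  open Graph G

  record OSep : Set₁ where
    constructor osep
    field
      A     : Subset V
      B     : Subset V
      cover : ∀ v → A v ⊎ B v
      noEdge : ∀ u v → (A ∖ B) u → (B ∖ A) v → ¬ E u v

  open OSep public

  swap : OSep → OSep
  swap (osep A B c n) = osep B A (λ v → Data.Sum.swap (c v))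
                              (λ u v p q e → n v u q p (E-sym e))
    where import Data.Sum

  FiniteOrder : OSep → Set
  FiniteOrder s = Finite (A s ∩ B s)

  OrderLt : ℕ → OSep → Set
  OrderLt k s = CardLt (A s ∩ B s) k

  SepSet : Set₂
  SepSet = OSep → Set₁

  _≈_ : OSep → OSep → Set
  s ≈ t = (A s ≐ A t) × (B s ≐ B t)

  _≤_ : OSep → OSep → Set
  s ≤ t = (A s ⊆ A t) × (B t ⊆ B s)

  _<_ₛ : OSep → OSep → Set
  s < t ₛ = (s ≤ t) × ¬ (s ≈ t)

  SameUnoriented : OSep → OSep → Set
  SameUnoriented s t = (s ≈ t) ⊎ (s ≈ swap t)

  S⃗ : ℕ → SepSet
  S⃗ k s = Level.Lift (lsuc 0ℓ) (OrderLt k s)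

  -- O is an orientation of S_k(G): O ⊆ \vec S_k, closed under ≈, and for each
  -- {A,B} ∈ S_k exactly one of (A,B),(B,A) lies in O (they may coincide).
  IsOrientation : ℕ → SepSet → Set₁
  IsOrientation k O =
      (∀ s → O s → S⃗ k s)
    × (∀ s t → s ≈ t → O s → O t)
    × (∀ s → S⃗ k s → O s ⊎ O (swap s))
    × (∀ s → S⃗ k s → O s → O (swap s) → s ≈ swap s)

  IsConsistent : SepSet → Set₁
  IsConsistent O = ∀ s t → ¬ SameUnoriented s t → s < t ₛ → O (swap s) → O t → ⊥

  IsVV : OSep → Set
  IsVV s = (∀ v → A s v) × (∀ v → B s v)

  IsStar : SepSet → Set₁
  IsStar σ = (∀ s → σ s → FiniteOrder s)
           × (∀ s → σ s → ¬ IsVV s)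
           × (∀ s t → σ s → σ t → ¬ (s ≈ t) → s ≤ swap t)

  interior : SepSet → V → Set₁
  interior σ v = ∀ s → σ s → B s v

  IsFTangle : ℕ → (SepSet → Set₁) → SepSet → Set₂
  IsFTangle k F O = IsOrientation k O × IsConsistent O
                  × (∀ σ → F σ → ¬ (∀ s → σ s → O s))

  record Ray : Set where
    field
      ray : ℕ → V
      inj : Injective _≡_ _≡_ ray
      adj : ∀ n → E (ray n) (ray (suc n))
  open Ray public

  data Conn (X : Subset V) : V → V → Set where
    here : ∀ {u} → ¬ X u → Conn X u u
    step : ∀ {u w v} → ¬ X u → E u w → Conn X w v → Conn X u v

  TailsSameComponent : Subset V → Ray → Ray → Set
  TailsSameComponent X R R' = Σ ℕ λ n → Σ ℕ λ m →
    ∀ i j → i ≥ n → j ≥ m → Conn X (ray R i) (ray R' j)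

  EquivRays : Ray → Ray → Set₁
  EquivRays R R' = ∀ (X : Subset V) → Finite X → TailsSameComponent X R R'

  record End : Set₁ where
    field
      member   : Ray → Set
      nonempty : Σ Ray member
      closed   : ∀ R R' → member R → EquivRays R R' → member R'
      related  : ∀ R R' → member R → member R' → EquivRays R R'
  open End public

  HasTailIn : Subset V → Ray → Set
  HasTailIn X R = Σ ℕ λ n → ∀ i → i ≥ n → X (ray R i)

  τ : End → OSep → Set₁
  τ ε s = Level.Lift (lsuc 0ℓ) (FiniteOrder s) × Σ Ray (λ R → member ε R × HasTailIn (B s ∖ A s) R)

{-# OPTIONS --safe #-}
-- A finite separator A ∩ B is avoided by a tail of every ray, and since no edge joins
-- A ∖ B to B ∖ A, such a tail lies entirely on one strict side.  Rays of one end choose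
-- the same side, because their tails are joined by paths avoiding A ∩ B.  So an end
-- orients every finite-order separation towards its tails; this side shrinks as the
-- separation grows, which is consistency.  For a star σ with finite interior, pick a
-- vertex v on a tail avoiding the interior: v ∉ B for some (A , B) ∈ σ.  The separator of
-- every member of a star lies in the interior, so the tail through v stays in A ∖ B, and
-- the end orients (A , B) as (B , A).
module Submission where

open import Defs
open import Level using (0ℓ; Lift; lift; lower) renaming (suc to lsuc)
open import Data.Nat using (ℕ; suc; _⊔_; _≥_; _≤′_; ≤′-refl; ≤′-step)
open import Data.Nat.Properties using (m≤m⊔n; m≤n⊔m; ≤-trans; ≤-refl; <-irrefl; ≤⇒≤′; ≤′⇒≤)
open import Data.Product using (Σ; _×_; _,_; proj₁; proj₂)
open import Data.Sum using (_⊎_; inj₁; inj₂)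
open import Data.Empty using (⊥-elim)
open import Data.List using (List; []; _∷_)
open import Data.List.Relation.Unary.Any using (here; there)
open import Data.List.Membership.Propositional using (_∉_)
open import Relation.Nullary using (¬_; Dec; yes; no)
open import Relation.Nullary.Decidable using (map′; decidable-stable)
open import Relation.Binary.PropositionalEquality using (_≡_; _≢_; sym; trans)
open import Axiom.ExcludedMiddle using (ExcludedMiddle)

decide : ExcludedMiddle (lsuc 0ℓ) → (P : Set) → Dec P
decide lem P = map′ lower lift (lem {Lift (lsuc 0ℓ) P})

module _ {X : Set} {P Q : Subset X} where

  ∩-comm-⊆ : (P ∩ Q) ⊆ (Q ∩ P)
  ∩-comm-⊆ _ (p , q) = q , p

  Finite-⊆ : P ⊆ Q → Finite Q → Finite P
  Finite-⊆ P⊆Q (l , Q⊆l) = l , λ x p → Q⊆l x (P⊆Q x p)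

  CardLt-⊆ : ∀ {k} → P ⊆ Q → CardLt Q k → CardLt P k
  CardLt-⊆ P⊆Q (l , l<k , Q⊆l) = l , l<k , λ x p → Q⊆l x (P⊆Q x p)

CardLt⇒Finite : ∀ {X : Set} {P : Subset X} {k} → CardLt P k → Finite P
CardLt⇒Finite (l , _ , P⊆l) = l , P⊆l

module _ {G : Graph} where
  open Graph G

  ≈⇒≥ : (s t : OSep G) → _≈_ G s t → _≤_ G t s
  ≈⇒≥ _ _ (A≐ , B≐) = proj₂ A≐ , proj₁ B≐

  ≈⇒separator-⊆ : (s t : OSep G) → _≈_ G s t → (A t ∩ B t) ⊆ (A s ∩ B s)
  ≈⇒separator-⊆ _ _ (A≐ , B≐) v (a , b) = proj₂ A≐ v a , proj₂ B≐ v b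

  ≤⇒strict-side-⊇ : (s t : OSep G) → _≤_ G s t → (B t ∖ A t) ⊆ (B s ∖ A s)
  ≤⇒strict-side-⊇ _ _ (As⊆At , Bt⊆Bs) v (b , ¬a) = Bt⊆Bs v b , λ a → ¬a (As⊆At v a)

  off-separator : (s : OSep G) {v : V} → ¬ (A s ∩ B s) v → (A s ∖ B s) v ⊎ (B s ∖ A s) v
  off-separator s {v} v∉X with cover s v
  ... | inj₁ a = inj₁ (a , λ b → v∉X (a , b))
  ... | inj₂ b = inj₂ (b , λ a → v∉X (a , b))

  strict-side-step : (s : OSep G) {u w : V} →
                     (A s ∖ B s) u → E u w → ¬ (A s ∩ B s) w → (A s ∖ B s) w
  strict-side-step s u∈ e w∉X with off-separator s w∉X
  ... | inj₁ w∈ = w∈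
  ... | inj₂ w∈ = ⊥-elim (noEdge s _ _ u∈ w∈ e)

  Conn-head : ∀ {X u v} → Conn G X u v → ¬ X u
  Conn-head (Conn.here u∉X)   = u∉X
  Conn-head (Conn.step u∉X _ _) = u∉X

  Conn-preserves-strict-side : (s : OSep G) {u v : V} →
                               Conn G (A s ∩ B s) u v → (A s ∖ B s) u → (A s ∖ B s) v
  Conn-preserves-strict-side s (Conn.here _)     u∈ = u∈
  Conn-preserves-strict-side s (Conn.step _ e c) u∈ =
    Conn-preserves-strict-side s c (strict-side-step s u∈ e (Conn-head c))

  tail-map : ∀ {P Q R} → P ⊆ Q → HasTailIn G P R → HasTailIn G Q R
  tail-map P⊆Q (n , inP) = n , λ i i≥n → P⊆Q _ (inP i i≥n)

  tail-∩ : ∀ {P Q R} → HasTailIn G P R → HasTailIn G Q R → HasTailIn G (P ∩ Q) R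
  tail-∩ (n , inP) (m , inQ) =
    n ⊔ m , λ i i≥ → inP i (≤-trans (m≤m⊔n n m) i≥) , inQ i (≤-trans (m≤n⊔m n m) i≥)

  ray-eventually-avoids : ExcludedMiddle (lsuc 0ℓ) → (R : Ray G) (x : V) → HasTailIn G (_≢ x) R
  ray-eventually-avoids lem R x with decide lem (Σ ℕ λ j → ray R j ≡ x)
  ... | no ∄j           = 0 , λ i _ rᵢ≡x → ∄j (i , rᵢ≡x)
  ... | yes (j , rⱼ≡x) = suc j , λ i i>j rᵢ≡x → <-irrefl (inj R (trans rⱼ≡x (sym rᵢ≡x))) i>j

  ray-eventually-avoids-list : ExcludedMiddle (lsuc 0ℓ) → (R : Ray G) (l : List V) →
                               HasTailIn G (_∉ l) R
  ray-eventually-avoids-list lem R []      = 0 , λ _ _ ()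
  ray-eventually-avoids-list lem R (x ∷ l) =
    tail-map {R = R} ∉-∷ (tail-∩ {P = _≢ x} {Q = _∉ l} {R = R}
                            (ray-eventually-avoids lem R x) (ray-eventually-avoids-list lem R l))
    where
    ∉-∷ : ((_≢ x) ∩ (_∉ l)) ⊆ (_∉ x ∷ l)
    ∉-∷ v (v≢x , v∉l) (here v≡x)  = v≢x v≡x
    ∉-∷ v (v≢x , v∉l) (there v∈l) = v∉l v∈l

  ray-eventually-avoids-finite : ExcludedMiddle (lsuc 0ℓ) → (R : Ray G) {X : Subset V} →
                                 Finite X → HasTailIn G (λ v → ¬ X v) R
  ray-eventually-avoids-finite lem R (l , X⊆l) with ray-eventually-avoids-list lem R l
  ... | N , ∉l = N , λ i i≥N X∋rᵢ → ∉l i i≥N (X⊆l _ X∋rᵢ)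

  ray-stays-on-strict-side : (s : OSep G) (R : Ray G) {N : ℕ} →
                             (∀ i → i ≥ N → ¬ (A s ∩ B s) (ray R i)) →
                             (A s ∖ B s) (ray R N) → HasTailIn G (A s ∖ B s) R
  ray-stays-on-strict-side s R {N} avoids start = N , λ i i≥N → stays (≤⇒≤′ i≥N)
    where
    stays : ∀ {i} → N ≤′ i → (A s ∖ B s) (ray R i)
    stays ≤′-refl            = start
    stays (≤′-step {i} N≤′i) =
      strict-side-step s (stays N≤′i) (adj R i) (avoids (suc i) (≤′⇒≤ (≤′-step N≤′i)))

  ray-tail-on-strict-side : ExcludedMiddle (lsuc 0ℓ) → (s : OSep G) → FiniteOrder G s →
                            (R : Ray G) → HasTailIn G (A s ∖ B s) R ⊎ HasTailIn G (B s ∖ A s) R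
  ray-tail-on-strict-side lem s fin R with ray-eventually-avoids-finite lem R fin
  ... | N , avoids with off-separator s (avoids N ≤-refl)
  ... | inj₁ start = inj₁ (ray-stays-on-strict-side s R avoids start)
  ... | inj₂ start = inj₂ (ray-stays-on-strict-side (swap G s) R
                             (λ i i≥N (b , a) → avoids i i≥N (a , b)) start)

  equivalent-rays-same-strict-side : (s : OSep G) → FiniteOrder G s → (R R′ : Ray G) →
    EquivRays G R R′ → HasTailIn G (A s ∖ B s) R → ¬ HasTailIn G (B s ∖ A s) R′
  equivalent-rays-same-strict-side s fin R R′ R~R′ (t , inA) (t′ , inB) with R~R′ (A s ∩ B s) fin
  ... | n , m , connected =
    proj₂ (Conn-preserves-strict-side s path (inA (n ⊔ t) (m≤n⊔m n t)))
          (proj₁ (inB (m ⊔ t′) (m≤n⊔m m t′)))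
    where path = connected (n ⊔ t) (m ⊔ t′) (m≤m⊔n n t) (m≤m⊔n m t′)

  star-separator⊆interior : ExcludedMiddle (lsuc 0ℓ) → {σ : SepSet G} → IsStar G σ →
                            ∀ {s} → σ s → ∀ v → (A s ∩ B s) v → interior G σ v
  star-separator⊆interior lem (_ , _ , ≤swap) {s} s∈σ v (a , b) t t∈σ with decide lem (_≈_ G s t)
  ... | yes (_ , B≐) = proj₁ B≐ v b
  ... | no s≉t       = proj₁ (≤swap s t s∈σ t∈σ s≉t) v a

  ¬interior⇒∃¬B : ExcludedMiddle (lsuc 0ℓ) → {σ : SepSet G} {v : V} →
                  ¬ interior G σ v → Σ (OSep G) λ s → σ s × ¬ B s v
  ¬interior⇒∃¬B lem {σ} {v} v∉int with lem {Σ (OSep G) λ s → σ s × ¬ B s v}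
  ... | yes ∃¬B = ∃¬B
  ... | no ∄¬B  = ⊥-elim (v∉int λ s s∈σ →
                    decidable-stable (decide lem (B s v)) λ v∉B → ∄¬B (s , s∈σ , v∉B))

  IsConsistent-subset : {O O′ : SepSet G} → (∀ s → O s → O′ s) →
                        IsConsistent G O′ → IsConsistent G O
  IsConsistent-subset O⊆O′ cons s t s≠t s<t s⁻∈O t∈O =
    cons s t s≠t s<t (O⊆O′ _ s⁻∈O) (O⊆O′ t t∈O)

  module _ (ε : End G) where

    τ-≤-closed : (s t : OSep G) → _≤_ G t s → FiniteOrder G t → τ G ε s → τ G ε t
    τ-≤-closed s t t≤s fin (_ , R , R∈ε , tail) =
      lift fin , R , R∈ε , tail-map {R = R} (≤⇒strict-side-⊇ t s t≤s) tail

    τ-asymmetric : (s : OSep G) → τ G ε s → ¬ τ G ε (swap G s)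
    τ-asymmetric s (lift fin , R , R∈ε , tailB) (_ , R′ , R′∈ε , tailA) =
      equivalent-rays-same-strict-side s fin R′ R (related ε R′ R R′∈ε R∈ε) tailA tailB

    τ-total : ExcludedMiddle (lsuc 0ℓ) → (s : OSep G) → FiniteOrder G s →
              τ G ε s ⊎ τ G ε (swap G s)
    τ-total lem s fin with nonempty ε
    ... | R , R∈ε with ray-tail-on-strict-side lem s fin R
    ... | inj₁ tailA = inj₂ (lift (Finite-⊆ ∩-comm-⊆ fin) , R , R∈ε , tailA)
    ... | inj₂ tailB = inj₁ (lift fin , R , R∈ε , tailB)

    τ-consistent : IsConsistent G (τ G ε)
    τ-consistent s t _ (s≤t , _) s⁻∈τ t∈τ =
      τ-asymmetric s (τ-≤-closed t s s≤t (Finite-⊆ ∩-comm-⊆ (lower (proj₁ s⁻∈τ))) t∈τ) s⁻∈τ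

    τ-orientation : ExcludedMiddle (lsuc 0ℓ) → (k : ℕ) →
                    IsOrientation G k (λ s → τ G ε s × S⃗ G k s)
    τ-orientation lem k = (λ _ → proj₂) , respects-≈ , total , antisymmetric
      where
      respects-≈ : ∀ s t → _≈_ G s t → τ G ε s × S⃗ G k s → τ G ε t × S⃗ G k t
      respects-≈ s t s≈t (s∈τ , lift s<k) =
        τ-≤-closed s t (≈⇒≥ s t s≈t) (Finite-⊆ separator-⊆ (lower (proj₁ s∈τ))) s∈τ ,
        lift (CardLt-⊆ separator-⊆ s<k)
        where separator-⊆ = ≈⇒separator-⊆ s t s≈t

      total : ∀ s → S⃗ G k s → τ G ε s × S⃗ G k s ⊎ τ G ε (swap G s) × S⃗ G k (swap G s)
      total s (lift s<k) with τ-total lem s (CardLt⇒Finite s<k)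
      ... | inj₁ s∈τ  = inj₁ (s∈τ , lift s<k)
      ... | inj₂ s⁻∈τ = inj₂ (s⁻∈τ , lift (CardLt-⊆ ∩-comm-⊆ s<k))

      antisymmetric : ∀ s → S⃗ G k s → τ G ε s × S⃗ G k s →
                      τ G ε (swap G s) × S⃗ G k (swap G s) → _≈_ G s (swap G s)
      antisymmetric s _ (s∈τ , _) (s⁻∈τ , _) = ⊥-elim (τ-asymmetric s s∈τ s⁻∈τ)

    τ-contains-no-star-with-finite-interior : ExcludedMiddle (lsuc 0ℓ) → {σ : SepSet G} →
      IsStar G σ → Finite (interior G σ) → ¬ (∀ s → σ s → τ G ε s)
    τ-contains-no-star-with-finite-interior lem star (l , int⊆l) σ⊆τ with nonempty ε
    ... | R , R∈ε with ray-eventually-avoids-list lem R l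
    ... | N , avoids with ¬interior⇒∃¬B lem (λ v∈int → avoids N ≤-refl (int⊆l _ v∈int))
    ... | s , s∈σ , v∉B =
      τ-asymmetric s (σ⊆τ s s∈σ)
        (lift (Finite-⊆ ∩-comm-⊆ (proj₁ star s s∈σ)) , R , R∈ε ,
         ray-stays-on-strict-side s R avoids-separator (v∈A , v∉B))
      where
      avoids-separator : ∀ i → i ≥ N → ¬ (A s ∩ B s) (ray R i)
      avoids-separator i i≥N X∋rᵢ =
        avoids i i≥N (int⊆l _ (star-separator⊆interior lem star s∈σ _ X∋rᵢ))

      v∈A : A s (ray R N)
      v∈A with cover s (ray R N)
      ... | inj₁ a = a
      ... | inj₂ b = ⊥-elim (v∉B b)

proposition3p1 : ExcludedMiddle (lsuc 0ℓ) →
    (G : Graph) (k : ℕ) (F : SepSet G → Set₁) →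
    (∀ σ → F σ → IsStar G σ × (∀ s → σ s → S⃗ G k s) × Finite (interior G σ)) →
    (ε : End G) →
    IsFTangle G k F (λ s → τ G ε s × S⃗ G k s)
proposition3p1 lem G k F F-stars ε =
  τ-orientation ε lem k ,
  IsConsistent-subset (λ _ → proj₁) (τ-consistent ε) ,
  λ σ σ∈F σ⊆O → let (star , _ , finite-interior) = F-stars σ σ∈F in
    τ-contains-no-star-with-finite-interior ε lem star finite-interior
      (λ s s∈σ → proj₁ (σ⊆O s s∈σ))
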